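{- For all integers $n,m\geq 0$, the following hold in the field of rational functions in $t_1,t_2,\dots$: \begin{align*} \sum_{k=0}^{n}A_{n+m,m+k}(\mathbf{t}) &= \frac{t_1\mathcal{Y}_{n+m+1}(\mathbf{t})-A_{n+m+1,m}(\mathbf{t})}{t_1},\\ \sum_{k=0}^{n}(k+1)A_{n+m,m+k}(\mathbf{t}) &= \frac{A_{n+m+2,m}(\mathbf{t})-t_1\mathcal{Y}_{n+m+2}(\mathbf{t})+(n+2)t_1^{2}\mathcal{Y}_{n+m+1}(\mathbf{t})}{t_1^2},\\ \sum_{k=0}^{n}(n-k+1)A_{n+m,m+k}(\mathbf{t}) &= \frac{t_1\mathcal{Y}_{n+m+2}(\mathbf{t})-A_{n+m+2,m}(\mathbf{t})-(n+2)t_1A_{n+m+1,m}(\mathbf{t})}{t_1^2}. \end{align*}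
   Context: $t_1,t_2,\dots$ are indeterminates. For a set partition $\pi$ assign each block of size $j$ the weight $t_j$, and let $w(\pi)$ be the product of its block weights. $\mathcal{Y}_n(\mathbf{t})$ is the sum of $w(\pi)$ over all partitions $\pi$ of $[n]=\{1,\dots,n\}$ ($\mathcal{Y}_0=1$). For $0\le k\le n$, $A_{n,k}(\mathbf{t})$ is the sum of $w(\pi)$ over all partitions of $[n+1]$ whose largest singleton block is $\{k+1\}$ (i.e. $\{k+1\}$ is a block and no $\{i\}$ with $i>k+1$ is a block). -}

module Defs where

open import Level using (_⊔_)
open import Data.Nat as ℕ using (ℕ; zero; suc; _≡ᵇ_; _∸_)
open import Data.Bool using (Bool; true; false; _∧_; not; if_then_else_)
open import Data.List using (List; []; _∷_; [_]; map; concatMap; length; foldr; upTo)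
open import Data.Bool.ListAction using (any)
open import Algebra.Bundles using (CommutativeRing)

-- A block of a set partition is a list of elements of [n] = {1,…,n};
-- a set partition is a list of blocks.
Block : Set
Block = List ℕ

Partition : Set
Partition = List Block

insertEach : ℕ → Partition → List Partition
insertEach x [] = []
insertEach x (b ∷ p) = ((x ∷ b) ∷ p) ∷ map (b ∷_) (insertEach x p)

-- The list of all set partitions of [n], each exactly once:
-- a partition of [n+1] is a partition of [n] with n+1 either added as a
-- new singleton block or inserted into exactly one existing block.
partitions : ℕ → List Partition
partitions zero = [ [] ]
partitions (suc n) =
  concatMap (λ p → ([ suc n ] ∷ p) ∷ insertEach (suc n) p) (partitions n)

isSingletonOf : ℕ → Block → Bool
isSingletonOf i (j ∷ []) = i ≡ᵇ j
isSingletonOf i _ = false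

hasSingletonBlock : ℕ → Partition → Bool
hasSingletonBlock i p = any (isSingletonOf i) p

-- For a partition p of [N]: {s} is a block and no {i} with s < i ≤ N is a block.
largestSingletonIs : ℕ → ℕ → Partition → Bool
largestSingletonIs N s p =
  hasSingletonBlock s p ∧
  not (any (λ j → hasSingletonBlock (suc (s ℕ.+ j)) p) (upTo (N ∸ s)))

module Weighted {c ℓ} (R : CommutativeRing c ℓ) where
  open CommutativeRing R

  sumR : List Carrier → Carrier
  sumR = foldr _+_ 0#

  Σ≤ : ℕ → (ℕ → Carrier) → Carrier
  Σ≤ n f = sumR (map f (upTo (suc n)))

  nat : ℕ → Carrier
  nat zero = 0#
  nat (suc n) = 1# + nat n

  weight : (ℕ → Carrier) → Partition → Carrier
  weight t p = foldr (λ b acc → t (length b) * acc) 1# p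

  𝒴 : (ℕ → Carrier) → ℕ → Carrier
  𝒴 t n = sumR (map (weight t) (partitions n))

  A : (ℕ → Carrier) → ℕ → ℕ → Carrier
  A t n k = sumR (map (λ p → if largestSingletonIs (suc n) (suc k) p
                               then weight t p else 0#)
                      (partitions (suc n)))

module Submission where

-- Write B K j for the total weight of the partitions of [K] having no
-- singleton block {i} with j < i ≤ K.  Everything rests on two facts.
--   (1) A_{K,a} = t₁ · B K a.  Deleting the singleton {a + 1} and closing
--       the gap in the labels is a bijection onto the partitions of [K]
--       that divides the weight by t₁.  Module Cleared
-- combines them into the three identities multiplied out by t₁ or t₁²: the
-- first is (2) times t₁, the second follows by summation by parts and (2)
-- one level up, the third is (n + 2) times the first minus the second.
-- The corollary then divides by the unit t₁.

open import Defs
open import Data.Nat as ℕ using (ℕ)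
import Data.Nat.Properties as ℕₚ
open import Data.Product using (_×_; _,_)
open import Algebra.Bundles using (CommutativeRing)

-- Ring-free combinatorics of `partitions`: the singleton-insertion bijection.
module Singletons where
  open import Data.Nat as ℕ using (ℕ; zero; suc; _≤_; _∸_; _≡ᵇ_; _<ᵇ_; z≤n; s≤s)
  import Data.Nat.Properties as ℕₚ
  open import Data.Bool using (Bool; true; false; _∧_; _∨_; if_then_else_; T?)
  open import Data.Bool.Properties using (∨-zeroʳ; ∧-zeroʳ; ∨-conicalˡ; ∨-conicalʳ)
  open import Data.Bool.ListAction using (all; any; or)
  open import Data.Empty using (⊥)
  open import Data.List using (List; []; _∷_; [_]; _++_; map; concat; concatMap; filterᵇ; upTo; applyUpTo)
  open import Data.List.Properties using (filter-++; map-∘; map-cong; map-cong-local; concatMap-map; map-concatMap; concatMap-pure; concatMap-cong; map-id-local; map-applyUpTo)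
  open import Data.List.Relation.Unary.All as All using (All; []; _∷_)
  open import Data.List.Relation.Unary.All.Properties using (concat⁺; map⁺)
  open import Function using (_∘_)
  open import Relation.Binary.PropositionalEquality using (_≡_; refl; sym; trans; subst; cong; cong₂; module ≡-Reasoning)

  private
    variable
      A B : Set

  filterᵇ-accept : (P : A → Bool) (x : A) (xs : List A) →
                   P x ≡ true → filterᵇ P (x ∷ xs) ≡ x ∷ filterᵇ P xs
  filterᵇ-accept P x xs Px rewrite Px = refl

  filterᵇ-reject : (P : A → Bool) (x : A) (xs : List A) →
                   P x ≡ false → filterᵇ P (x ∷ xs) ≡ filterᵇ P xs
  filterᵇ-reject P x xs Px rewrite Px = refl

  filterᵇ-concatMap : (P : B → Bool) (f : A → List B) (xs : List A) →
                      filterᵇ P (concatMap f xs) ≡ concatMap (filterᵇ P ∘ f) xs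
  filterᵇ-concatMap P f [] = refl
  filterᵇ-concatMap P f (x ∷ xs) =
    trans (filter-++ (T? ∘ P) (f x) (concatMap f xs))
          (cong (filterᵇ P (f x) ++_) (filterᵇ-concatMap P f xs))

  concatMap-filterᵇ : (P : A → Bool) (h : A → List B) → (∀ x → P x ≡ false → h x ≡ []) →
                      (xs : List A) → concatMap h xs ≡ concatMap h (filterᵇ P xs)
  concatMap-filterᵇ P h h-vanishes [] = refl
  concatMap-filterᵇ P h h-vanishes (x ∷ xs) with P x in Px
  ... | true  = cong (h x ++_) (concatMap-filterᵇ P h h-vanishes xs)
  ... | false = trans (cong (_++ concatMap h xs) (h-vanishes x Px))
                      (concatMap-filterᵇ P h h-vanishes xs)

  ≡ᵇ-refl : ∀ m → (m ≡ᵇ m) ≡ true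
  ≡ᵇ-refl zero    = refl
  ≡ᵇ-refl (suc m) = ≡ᵇ-refl m

  <ᵇ⇒≢ᵇ : ∀ m n → (m <ᵇ n) ≡ true → (m ≡ᵇ n) ≡ false
  <ᵇ⇒≢ᵇ zero    (suc n) _    = refl
  <ᵇ⇒≢ᵇ (suc m) (suc n) m<n = <ᵇ⇒≢ᵇ m n m<n

  <ᵇ⇒≢ᵇ′ : ∀ m n → (m <ᵇ n) ≡ true → (n ≡ᵇ m) ≡ false
  <ᵇ⇒≢ᵇ′ zero    (suc n) _    = refl
  <ᵇ⇒≢ᵇ′ (suc m) (suc n) m<n = <ᵇ⇒≢ᵇ′ m n m<n

  ≤⇒<ᵇsuc : ∀ {m n} → m ≤ n → (m <ᵇ suc n) ≡ true
  ≤⇒<ᵇsuc z≤n       = refl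
  ≤⇒<ᵇsuc (s≤s m≤n) = ≤⇒<ᵇsuc m≤n

  ≤⇒≮ᵇ : ∀ {m n} → m ≤ n → (n <ᵇ m) ≡ false
  ≤⇒≮ᵇ {n = zero}  z≤n = refl
  ≤⇒≮ᵇ {n = suc n} z≤n = refl
  ≤⇒≮ᵇ (s≤s m≤n)       = ≤⇒≮ᵇ m≤n

  -- shiftAbove a is the order-preserving injection of ℕ that skips a + 1:
  -- it fixes x ≤ a and sends x > a to x + 1.
  shiftAbove : ℕ → ℕ → ℕ
  shiftAbove zero    zero    = zero
  shiftAbove zero    (suc x) = suc (suc x)
  shiftAbove (suc a) zero    = zero
  shiftAbove (suc a) (suc x) = suc (shiftAbove a x)

  shiftAbove-above : ∀ a x → (a <ᵇ x) ≡ true → shiftAbove a x ≡ suc x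
  shiftAbove-above zero    (suc x) _   = refl
  shiftAbove-above (suc a) (suc x) a<x = cong suc (shiftAbove-above a x a<x)

  shiftAbove-below : ∀ a x → (a <ᵇ x) ≡ false → shiftAbove a x ≡ x
  shiftAbove-below zero    zero    _   = refl
  shiftAbove-below (suc a) zero    _   = refl
  shiftAbove-below (suc a) (suc x) a≮x = cong suc (shiftAbove-below a x a≮x)

  shiftAbove-skips : ∀ a x → (suc a ≡ᵇ shiftAbove a x) ≡ false
  shiftAbove-skips zero    zero    = refl
  shiftAbove-skips zero    (suc x) = refl
  shiftAbove-skips (suc a) zero    = refl
  shiftAbove-skips (suc a) (suc x) = shiftAbove-skips a x

  -- Above a, shiftAbove a is the successor, so it reflects equality there.
  shiftAbove-≡ᵇ : ∀ a i x → (a <ᵇ i) ≡ true → (suc i ≡ᵇ shiftAbove a x) ≡ (i ≡ᵇ x)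
  shiftAbove-≡ᵇ zero    (suc i) zero    _   = refl
  shiftAbove-≡ᵇ zero    (suc i) (suc x) _   = refl
  shiftAbove-≡ᵇ (suc a) (suc i) zero    _   = refl
  shiftAbove-≡ᵇ (suc a) (suc i) (suc x) a<i = shiftAbove-≡ᵇ a i x a<i

  insertEach-relabel : (f : ℕ → ℕ) (x : ℕ) (p : Partition) →
    insertEach (f x) (map (map f) p) ≡ map (map (map f)) (insertEach x p)
  insertEach-relabel f x [] = refl
  insertEach-relabel f x (b ∷ p) = cong (((f x ∷ map f b) ∷ map (map f) p) ∷_) (begin
    map (map f b ∷_) (insertEach (f x) (map (map f) p))     ≡⟨ cong (map (map f b ∷_)) (insertEach-relabel f x p) ⟩
    map (map f b ∷_) (map (map (map f)) (insertEach x p))   ≡⟨ map-∘ (insertEach x p) ⟨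
    map (map (map f) ∘ (b ∷_)) (insertEach x p)             ≡⟨ map-∘ (insertEach x p) ⟩
    map (map (map f)) (map (b ∷_) (insertEach x p))         ∎)
    where open ≡-Reasoning

  -- For a partition p of [K] whose blocks are
  -- listed as `partitions` lists them, insertSingleton a p is the partition of
  -- [K + 1] obtained by relabelling x ↦ shiftAbove a x and adding the block
  -- {a + 1}, placed where `partitions (K + 1)` would list it: before the first
  -- block having an element ≤ a.
  liesAbove : ℕ → Block → Bool
  liesAbove a b = all (a <ᵇ_) b

  relabelAndPrepend : ℕ → Partition → Partition
  relabelAndPrepend a q = [ suc a ] ∷ map (map (shiftAbove a)) q

  insertSingleton : ℕ → Partition → Partition
  insertSingleton a [] = [ [ suc a ] ]
  insertSingleton a (b ∷ p) =
    if liesAbove a b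
    then map (shiftAbove a) b ∷ insertSingleton a p
    else relabelAndPrepend a (b ∷ p)

  insertSingleton-above : ∀ a b p → liesAbove a b ≡ true →
    insertSingleton a (b ∷ p) ≡ map (shiftAbove a) b ∷ insertSingleton a p
  insertSingleton-above a b p above rewrite above = refl

  insertSingleton-below : ∀ a b p → liesAbove a b ≡ false →
    insertSingleton a (b ∷ p) ≡ relabelAndPrepend a (b ∷ p)
  insertSingleton-below a b p below rewrite below = refl

  isSingletonOf-shifted : ∀ a b → isSingletonOf (suc a) (map (shiftAbove a) b) ≡ false
  isSingletonOf-shifted a []          = refl
  isSingletonOf-shifted a (x ∷ [])    = shiftAbove-skips a x
  isSingletonOf-shifted a (x ∷ _ ∷ _) = refl

  hasSingleton-shifted : ∀ a q → hasSingletonBlock (suc a) (map (map (shiftAbove a)) q) ≡ false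
  hasSingleton-shifted a []      = refl
  hasSingleton-shifted a (b ∷ q) = cong₂ _∨_ (isSingletonOf-shifted a b) (hasSingleton-shifted a q)

  isSingletonOf-shiftedAbove : ∀ a i b → (a <ᵇ i) ≡ true →
    isSingletonOf (suc i) (map (shiftAbove a) b) ≡ isSingletonOf i b
  isSingletonOf-shiftedAbove a i []          a<i = refl
  isSingletonOf-shiftedAbove a i (x ∷ [])    a<i = shiftAbove-≡ᵇ a i x a<i
  isSingletonOf-shiftedAbove a i (x ∷ _ ∷ _) a<i = refl

  hasSingleton-shiftedAbove : ∀ a i q → (a <ᵇ i) ≡ true →
    hasSingletonBlock (suc i) (map (map (shiftAbove a)) q) ≡ hasSingletonBlock i q
  hasSingleton-shiftedAbove a i []      a<i = refl
  hasSingleton-shiftedAbove a i (b ∷ q) a<i =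
    cong₂ _∨_ (isSingletonOf-shiftedAbove a i b a<i) (hasSingleton-shiftedAbove a i q a<i)

  hasSingleton-inserted : ∀ a p → hasSingletonBlock (suc a) (insertSingleton a p) ≡ true
  hasSingleton-inserted a [] rewrite ≡ᵇ-refl a = refl
  hasSingleton-inserted a (b ∷ p) with liesAbove a b
  ... | true  = trans (cong (isSingletonOf (suc a) (map (shiftAbove a) b) ∨_) (hasSingleton-inserted a p)) (∨-zeroʳ _)
  ... | false rewrite ≡ᵇ-refl a = refl

  hasSingleton-insertedAbove : ∀ a i p → (a <ᵇ i) ≡ true →
    hasSingletonBlock (suc i) (insertSingleton a p) ≡ hasSingletonBlock i p
  hasSingleton-insertedAbove a i [] a<i = cong (_∨ false) (<ᵇ⇒≢ᵇ′ a i a<i)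
  hasSingleton-insertedAbove a i (b ∷ p) a<i with liesAbove a b
  ... | true  = cong₂ _∨_ (isSingletonOf-shiftedAbove a i b a<i) (hasSingleton-insertedAbove a i p a<i)
  ... | false = cong₂ _∨_ (<ᵇ⇒≢ᵇ′ a i a<i) (hasSingleton-shiftedAbove a i (b ∷ p) a<i)

  filter-sharedBlock : ∀ i c qs → isSingletonOf i c ≡ false →
    filterᵇ (hasSingletonBlock i) (map (c ∷_) qs) ≡ map (c ∷_) (filterᵇ (hasSingletonBlock i) qs)
  filter-sharedBlock i c [] c≢i = refl
  filter-sharedBlock i c (q ∷ qs) c≢i rewrite c≢i with hasSingletonBlock i q
  ... | true  = cong ((c ∷ q) ∷_) (filter-sharedBlock i c qs c≢i)
  ... | false = filter-sharedBlock i c qs c≢i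

  filter-sharedSingleton : ∀ i c qs → isSingletonOf i c ≡ true →
    filterᵇ (hasSingletonBlock i) (map (c ∷_) qs) ≡ map (c ∷_) qs
  filter-sharedSingleton i c [] c≡i = refl
  filter-sharedSingleton i c (q ∷ qs) c≡i rewrite c≡i = cong ((c ∷ q) ∷_) (filter-sharedSingleton i c qs c≡i)

  insertEach-noSingleton : ∀ i x q → All (λ b → isSingletonOf i (x ∷ b) ≡ false) q →
    hasSingletonBlock i q ≡ false → filterᵇ (hasSingletonBlock i) (insertEach x q) ≡ []
  insertEach-noSingleton i x [] [] _ = refl
  insertEach-noSingleton i x (b ∷ q) (xb≢i ∷ xq≢i) bq≢i = begin
    filterᵇ (hasSingletonBlock i) (((x ∷ b) ∷ q) ∷ map (b ∷_) (insertEach x q))  ≡⟨ filterᵇ-reject (hasSingletonBlock i) ((x ∷ b) ∷ q) (map (b ∷_) (insertEach x q)) (cong₂ _∨_ xb≢i q≢i) ⟩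
    filterᵇ (hasSingletonBlock i) (map (b ∷_) (insertEach x q))                  ≡⟨ filter-sharedBlock i b (insertEach x q) b≢i ⟩
    map (b ∷_) (filterᵇ (hasSingletonBlock i) (insertEach x q))                  ≡⟨ cong (map (b ∷_)) (insertEach-noSingleton i x q xq≢i q≢i) ⟩
    []                                                            ∎
    where
    open ≡-Reasoning
    b≢i = ∨-conicalˡ _ _ bq≢i
    q≢i = ∨-conicalʳ _ _ bq≢i

  map-insertSingleton-above : ∀ a b qs → liesAbove a b ≡ true →
    map (insertSingleton a) (map (b ∷_) qs) ≡ map (map (shiftAbove a) b ∷_) (map (insertSingleton a) qs)
  map-insertSingleton-above a b qs above = begin
    map (insertSingleton a) (map (b ∷_) qs)                 ≡⟨ map-∘ qs ⟨
    map (insertSingleton a ∘ (b ∷_)) qs                     ≡⟨ map-cong (λ q → insertSingleton-above a b q above) qs ⟩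
    map ((map (shiftAbove a) b ∷_) ∘ insertSingleton a) qs  ≡⟨ map-∘ qs ⟩
    map (map (shiftAbove a) b ∷_) (map (insertSingleton a) qs) ∎
    where open ≡-Reasoning

  -- If the first block b does not lie above a, neither does y ∷ b, so
  -- {a + 1} goes in front of every partition in insertEach y (b ∷ p).
  map-insertSingleton-below : ∀ a y b p → liesAbove a b ≡ false →
    map (insertSingleton a) (insertEach y (b ∷ p)) ≡ map (relabelAndPrepend a) (insertEach y (b ∷ p))
  map-insertSingleton-below a y b p below =
    cong₂ _∷_ (insertSingleton-below a (y ∷ b) p (trans (cong ((a <ᵇ y) ∧_) below) (∧-zeroʳ _)))
              (begin
      map (insertSingleton a) (map (b ∷_) (insertEach y p))  ≡⟨ map-∘ (insertEach y p) ⟨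
      map (insertSingleton a ∘ (b ∷_)) (insertEach y p)      ≡⟨ map-cong (λ q → insertSingleton-below a b q below) (insertEach y p) ⟩
      map (relabelAndPrepend a ∘ (b ∷_)) (insertEach y p)    ≡⟨ map-∘ (insertEach y p) ⟩
      map (relabelAndPrepend a) (map (b ∷_) (insertEach y p)) ∎)
    where open ≡-Reasoning

  insertEach-insertSingleton : ∀ a y p → (a <ᵇ y) ≡ true →
    filterᵇ (hasSingletonBlock (suc a)) (insertEach (suc y) (insertSingleton a p)) ≡ map (insertSingleton a) (insertEach y p)
  insertEach-insertSingleton a y [] a<y = refl
  insertEach-insertSingleton a y (b ∷ p) a<y = by-position (liesAbove a b) refl
    where
    open ≡-Reasoning
    b′ = map (shiftAbove a) b
    ins = insertSingleton a

    by-position : (g : Bool) → liesAbove a b ≡ g →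
      filterᵇ (hasSingletonBlock (suc a)) (insertEach (suc y) (ins (b ∷ p))) ≡ map ins (insertEach y (b ∷ p))
    -- b stays in front of {a + 1}: induction on the remaining blocks.
    by-position true above = begin
      filterᵇ (hasSingletonBlock (suc a)) (insertEach (suc y) (ins (b ∷ p)))
        ≡⟨ cong (filterᵇ (hasSingletonBlock (suc a)) ∘ insertEach (suc y)) (insertSingleton-above a b p above) ⟩
      filterᵇ (hasSingletonBlock (suc a)) (((suc y ∷ b′) ∷ ins p) ∷ map (b′ ∷_) (insertEach (suc y) (ins p)))
        ≡⟨ filterᵇ-accept (hasSingletonBlock (suc a)) ((suc y ∷ b′) ∷ ins p) (map (b′ ∷_) (insertEach (suc y) (ins p))) (trans (cong (isSingletonOf (suc a) (suc y ∷ b′) ∨_) (hasSingleton-inserted a p)) (∨-zeroʳ _)) ⟩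
      ((suc y ∷ b′) ∷ ins p) ∷ filterᵇ (hasSingletonBlock (suc a)) (map (b′ ∷_) (insertEach (suc y) (ins p)))
        ≡⟨ cong₂ _∷_ new-block (filter-sharedBlock (suc a) b′ (insertEach (suc y) (ins p)) (isSingletonOf-shifted a b)) ⟩
      ins ((y ∷ b) ∷ p) ∷ map (b′ ∷_) (filterᵇ (hasSingletonBlock (suc a)) (insertEach (suc y) (ins p)))
        ≡⟨ cong (λ qs → ins ((y ∷ b) ∷ p) ∷ map (b′ ∷_) qs) (insertEach-insertSingleton a y p a<y) ⟩
      ins ((y ∷ b) ∷ p) ∷ map (b′ ∷_) (map ins (insertEach y p))
        ≡⟨ cong (ins ((y ∷ b) ∷ p) ∷_) (map-insertSingleton-above a b (insertEach y p) above) ⟨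
      ins ((y ∷ b) ∷ p) ∷ map ins (map (b ∷_) (insertEach y p))
        ∎
      where
      new-block : (suc y ∷ b′) ∷ ins p ≡ ins ((y ∷ b) ∷ p)
      new-block = sym (trans (insertSingleton-above a (y ∷ b) p (cong₂ _∧_ a<y above))
                             (cong (λ z → (z ∷ b′) ∷ ins p) (shiftAbove-above a y a<y)))
    -- {a + 1} comes first, and is kept by every insertion of y + 1.
    by-position false below = begin
      filterᵇ (hasSingletonBlock (suc a)) (insertEach (suc y) (ins (b ∷ p)))
        ≡⟨ cong (filterᵇ (hasSingletonBlock (suc a)) ∘ insertEach (suc y)) (insertSingleton-below a b p below) ⟩
      filterᵇ (hasSingletonBlock (suc a)) (((suc y ∷ [ suc a ]) ∷ q′) ∷ map ([ suc a ] ∷_) (insertEach (suc y) q′))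
        ≡⟨ filterᵇ-reject (hasSingletonBlock (suc a)) ((suc y ∷ [ suc a ]) ∷ q′) (map ([ suc a ] ∷_) (insertEach (suc y) q′)) (hasSingleton-shifted a (b ∷ p)) ⟩
      filterᵇ (hasSingletonBlock (suc a)) (map ([ suc a ] ∷_) (insertEach (suc y) q′))
        ≡⟨ filter-sharedSingleton (suc a) [ suc a ] (insertEach (suc y) q′) (≡ᵇ-refl a) ⟩
      map ([ suc a ] ∷_) (insertEach (suc y) q′)
        ≡⟨ cong (λ z → map ([ suc a ] ∷_) (insertEach z q′)) (shiftAbove-above a y a<y) ⟨
      map ([ suc a ] ∷_) (insertEach (shiftAbove a y) q′)
        ≡⟨ cong (map ([ suc a ] ∷_)) (insertEach-relabel (shiftAbove a) y (b ∷ p)) ⟩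
      map ([ suc a ] ∷_) (map (map (map (shiftAbove a))) (insertEach y (b ∷ p)))
        ≡⟨ map-∘ (insertEach y (b ∷ p)) ⟨
      map (relabelAndPrepend a) (insertEach y (b ∷ p))
        ≡⟨ map-insertSingleton-below a y b p below ⟨
      map ins (insertEach y (b ∷ p))
        ∎
      where
      q′ = map (map (shiftAbove a)) (b ∷ p)

  WithinBlock : ℕ → Block → Set
  WithinBlock m []      = ⊥
  WithinBlock m (x ∷ b) = All (_≤ m) (x ∷ b)

  bounded : ∀ {m} b → WithinBlock m b → All (_≤ m) b
  bounded (x ∷ b) h = h

  raise : ∀ {m} b → WithinBlock m b → WithinBlock (suc m) b
  raise (x ∷ b) h = All.map ℕₚ.m≤n⇒m≤1+n h

  insertEach-within : ∀ m q → All (WithinBlock m) q → All (All (WithinBlock (suc m))) (insertEach (suc m) q)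
  insertEach-within m [] [] = []
  insertEach-within m (b ∷ q) (hb ∷ hq) =
    ((ℕₚ.≤-refl ∷ bounded b (raise b hb)) ∷ All.map (raise _) hq)
    ∷ map⁺ (All.map (raise b hb ∷_) (insertEach-within m q hq))

  partitions-within : ∀ m → All (All (WithinBlock m)) (partitions m)
  partitions-within zero    = [] ∷ []
  partitions-within (suc m) = concat⁺ (map⁺ (All.map extend (partitions-within m)))
    where
    extend : ∀ {q} → All (WithinBlock m) q →
             All (All (WithinBlock (suc m))) (([ suc m ] ∷ q) ∷ insertEach (suc m) q)
    extend {q} h = ((ℕₚ.≤-refl ∷ []) ∷ All.map (raise _) h) ∷ insertEach-within m q h

  -- On a partition of [a] nothing is relabelled, so {a + 1} just goes in front.
  insertSingleton-top : ∀ a q → All (WithinBlock a) q → insertSingleton a q ≡ [ suc a ] ∷ q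
  insertSingleton-top a [] [] = refl
  insertSingleton-top a ((x ∷ b) ∷ q) h@(hb ∷ _) =
    trans (insertSingleton-below a (x ∷ b) q (cong (_∧ liesAbove a b) (≤⇒≮ᵇ (All.head hb))))
          (cong ([ suc a ] ∷_) (map-id-local (All.map fixes h)))
    where
    fixes : ∀ {c} → WithinBlock a c → map (shiftAbove a) c ≡ c
    fixes {c} hc = map-id-local (All.map (λ y≤a → shiftAbove-below a _ (≤⇒≮ᵇ y≤a)) (bounded c hc))

  noSingleton-top : ∀ a q → All (WithinBlock a) q → hasSingletonBlock (suc a) q ≡ false
  noSingleton-top a [] [] = refl
  noSingleton-top a ((x ∷ []) ∷ q) ((x≤a ∷ []) ∷ h) =
    cong₂ _∨_ (<ᵇ⇒≢ᵇ′ x (suc a) (≤⇒<ᵇsuc x≤a)) (noSingleton-top a q h)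
  noSingleton-top a ((x ∷ _ ∷ _) ∷ q) (_ ∷ h) = noSingleton-top a q h

  -- Induction on K = d + a: for K = a the block
  -- {a + 1} must be the new singleton; for larger K, filtering commutes with
  -- the recursive step of `partitions` by insertEach-insertSingleton.
  singletonFilter-+ : ∀ a d →
    filterᵇ (hasSingletonBlock (suc a)) (partitions (suc (d ℕ.+ a))) ≡ map (insertSingleton a) (partitions (d ℕ.+ a))
  singletonFilter-+ a zero = begin
    filterᵇ (hasSingletonBlock (suc a)) (concatMap new (partitions a))  ≡⟨ filterᵇ-concatMap (hasSingletonBlock (suc a)) new (partitions a) ⟩
    concatMap (filterᵇ (hasSingletonBlock (suc a)) ∘ new) (partitions a)
      ≡⟨ cong concat (map-cong-local (All.map only-new (partitions-within a))) ⟩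
    concatMap ([_] ∘ insertSingleton a) (partitions a)   ≡⟨ concatMap-map [_] (insertSingleton a) (partitions a) ⟨
    concatMap [_] (map (insertSingleton a) (partitions a)) ≡⟨ concatMap-pure _ ⟩
    map (insertSingleton a) (partitions a)               ∎
    where
    open ≡-Reasoning
    new : Partition → List Partition
    new q = ([ suc a ] ∷ q) ∷ insertEach (suc a) q
    not-singleton : ∀ {b} → WithinBlock a b → isSingletonOf (suc a) (suc a ∷ b) ≡ false
    not-singleton {_ ∷ _} _ = refl
    only-new : ∀ {q} → All (WithinBlock a) q → filterᵇ (hasSingletonBlock (suc a)) (new q) ≡ [ insertSingleton a q ]
    only-new {q} h = begin
      filterᵇ (hasSingletonBlock (suc a)) (new q)
        ≡⟨ filterᵇ-accept (hasSingletonBlock (suc a)) ([ suc a ] ∷ q) (insertEach (suc a) q) (cong (_∨ hasSingletonBlock (suc a) q) (≡ᵇ-refl a)) ⟩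
      ([ suc a ] ∷ q) ∷ filterᵇ (hasSingletonBlock (suc a)) (insertEach (suc a) q)
        ≡⟨ cong₂ _∷_ (sym (insertSingleton-top a q h)) (insertEach-noSingleton (suc a) (suc a) q (All.map not-singleton h) (noSingleton-top a q h)) ⟩
      [ insertSingleton a q ] ∎
  singletonFilter-+ a (suc d) = begin
    filterᵇ P (concatMap new (partitions (suc K)))      ≡⟨ filterᵇ-concatMap P new (partitions (suc K)) ⟩
    concatMap (filterᵇ P ∘ new) (partitions (suc K))    ≡⟨ concatMap-filterᵇ P (filterᵇ P ∘ new) vanishes (partitions (suc K)) ⟩
    concatMap (filterᵇ P ∘ new) (filterᵇ P (partitions (suc K)))
      ≡⟨ cong (concatMap (filterᵇ P ∘ new)) (singletonFilter-+ a d) ⟩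
    concatMap (filterᵇ P ∘ new) (map (insertSingleton a) (partitions K))
      ≡⟨ concatMap-map (filterᵇ P ∘ new) (insertSingleton a) (partitions K) ⟩
    concatMap (filterᵇ P ∘ new ∘ insertSingleton a) (partitions K)
      ≡⟨ concatMap-cong commutes (partitions K) ⟩
    concatMap (map (insertSingleton a) ∘ new′) (partitions K)
      ≡⟨ map-concatMap (insertSingleton a) new′ (partitions K) ⟨
    map (insertSingleton a) (partitions (suc K))        ∎
    where
    open ≡-Reasoning
    K = d ℕ.+ a
    P = hasSingletonBlock (suc a)
    a<ᵇ1+K : (a <ᵇ suc K) ≡ true
    a<ᵇ1+K = ≤⇒<ᵇsuc (ℕₚ.m≤n+m a d)
    new new′ : Partition → List Partition
    new  q = ([ suc (suc K) ] ∷ q) ∷ insertEach (suc (suc K)) q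
    new′ q = ([ suc K ] ∷ q) ∷ insertEach (suc K) q
    not-singleton : ∀ b → isSingletonOf (suc a) (suc (suc K) ∷ b) ≡ false
    not-singleton []      = <ᵇ⇒≢ᵇ a (suc K) a<ᵇ1+K
    not-singleton (_ ∷ _) = refl
    vanishes : ∀ q → P q ≡ false → filterᵇ P (new q) ≡ []
    vanishes q q≢ = trans (filterᵇ-reject P ([ suc (suc K) ] ∷ q) (insertEach (suc (suc K)) q) (cong₂ _∨_ (not-singleton []) q≢))
                          (insertEach-noSingleton (suc a) (suc (suc K)) q (All.universal not-singleton q) q≢)
    commutes : ∀ p → filterᵇ P (new (insertSingleton a p)) ≡ map (insertSingleton a) (new′ p)
    commutes p = trans (filterᵇ-accept P ([ suc (suc K) ] ∷ insertSingleton a p) (insertEach (suc (suc K)) (insertSingleton a p))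
                          (trans (cong (_ ∨_) (hasSingleton-inserted a p)) (∨-zeroʳ _)))
                       (cong₂ _∷_ (sym new-block) (insertEach-insertSingleton a (suc K) p a<ᵇ1+K))
      where
      new-block : insertSingleton a ([ suc K ] ∷ p) ≡ [ suc (suc K) ] ∷ insertSingleton a p
      new-block = trans (insertSingleton-above a [ suc K ] p (cong (_∧ true) a<ᵇ1+K))
                        (cong (λ z → [ z ] ∷ insertSingleton a p) (shiftAbove-above a (suc K) a<ᵇ1+K))

  singletonFilter : ∀ a K → a ≤ K →
    filterᵇ (hasSingletonBlock (suc a)) (partitions (suc K)) ≡ map (insertSingleton a) (partitions K)
  singletonFilter a K a≤K = subst (λ N → filterᵇ (hasSingletonBlock (suc a)) (partitions (suc N)) ≡ map (insertSingleton a) (partitions N))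
                                  (ℕₚ.m∸n+n≡m a≤K) (singletonFilter-+ a (K ℕ.∸ a))

  singletonsAbove-split : ∀ N a p → a ≤ N →
    any (λ i → hasSingletonBlock (suc (a ℕ.+ i)) p) (upTo (suc N ∸ a))
      ≡ hasSingletonBlock (suc a) p ∨ any (λ i → hasSingletonBlock (suc (suc a ℕ.+ i)) p) (upTo (N ∸ a))
  singletonsAbove-split N a p a≤N = begin
    any has (upTo (suc N ∸ a))                    ≡⟨ cong (any has ∘ upTo) (ℕₚ.+-∸-assoc 1 a≤N) ⟩
    has 0 ∨ or (map has (applyUpTo suc (N ∸ a)))  ≡⟨ cong (λ L → has 0 ∨ or L) (map-applyUpTo suc has (N ∸ a)) ⟩
    has 0 ∨ or (applyUpTo (has ∘ suc) (N ∸ a))    ≡⟨ cong (λ L → has 0 ∨ or L) (map-applyUpTo (λ i → i) (has ∘ suc) (N ∸ a)) ⟨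
    has 0 ∨ any (has ∘ suc) (upTo (N ∸ a))        ≡⟨ cong₂ _∨_ (cong (λ i → hasSingletonBlock (suc i) p) (ℕₚ.+-identityʳ a))
                                                     (cong or (map-cong (λ i → cong (λ j → hasSingletonBlock (suc j) p) (ℕₚ.+-suc a i)) (upTo (N ∸ a)))) ⟩
    hasSingletonBlock (suc a) p ∨ any (λ i → hasSingletonBlock (suc (suc a ℕ.+ i)) p) (upTo (N ∸ a)) ∎
    where
    open ≡-Reasoning
    has : ℕ → Bool
    has i = hasSingletonBlock (suc (a ℕ.+ i)) p


-- Weighted sums over partitions in an arbitrary commutative ring.
module WeightedIdentities {c ℓ} (R : CommutativeRing c ℓ) where
  open import Data.Nat as ℕ using (ℕ; zero; suc; _≤_; _∸_; z≤n; s≤s)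
  import Data.Nat.Properties as ℕₚ
  open import Data.Bool using (Bool; true; false; _∧_; _∨_; not; if_then_else_)
  open import Data.Bool.ListAction using (any; or)
  open import Data.List using ([]; _∷_; map; filterᵇ; length; upTo)
  open import Data.List.Properties using (map-∘; map-cong; length-map; map-applyUpTo)
  open import Function using (_∘_)
  open import Data.Nat.Tactic.RingSolver using (solve-∀)
  import Relation.Binary.PropositionalEquality as ≡
  open import Relation.Binary.PropositionalEquality using (_≡_)

  open Singletons
  open CommutativeRing R
  open Weighted R
  open import Relation.Binary.Reasoning.Setoid setoid
  open import Algebra.Solver.Ring.NaturalCoefficients.Default commutativeSemiring
    using (solve; _:+_; _:*_; _:=_; con)
  open import Algebra.Properties.Group +-group using (x≈z//y) renaming (∙-cancelʳ to +-cancelʳ)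

  private
    variable
      X : Set

  sumR-cong : {f g : X → Carrier} → (∀ x → f x ≈ g x) → ∀ xs → sumR (map f xs) ≈ sumR (map g xs)
  sumR-cong f≈g []       = refl
  sumR-cong f≈g (x ∷ xs) = +-cong (f≈g x) (sumR-cong f≈g xs)

  sumR-+ : (f g : X → Carrier) → ∀ xs → sumR (map (λ x → f x + g x) xs) ≈ sumR (map f xs) + sumR (map g xs)
  sumR-+ f g []       = sym (+-identityˡ 0#)
  sumR-+ f g (x ∷ xs) = begin
    (f x + g x) + sumR (map (λ x → f x + g x) xs)       ≈⟨ +-congˡ (sumR-+ f g xs) ⟩
    (f x + g x) + (sumR (map f xs) + sumR (map g xs))   ≈⟨ +-middle (f x) (g x) _ _ ⟩
    (f x + sumR (map f xs)) + (g x + sumR (map g xs))   ∎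
    where
    +-middle : ∀ a b c d → (a + b) + (c + d) ≈ (a + c) + (b + d)
    +-middle = solve 4 (λ a b c d → (a :+ b) :+ (c :+ d) := (a :+ c) :+ (b :+ d)) refl

  sumR-* : (k : Carrier) (f : X → Carrier) → ∀ xs → sumR (map (λ x → k * f x) xs) ≈ k * sumR (map f xs)
  sumR-* k f []       = sym (zeroʳ k)
  sumR-* k f (x ∷ xs) = trans (+-congˡ (sumR-* k f xs)) (sym (distribˡ k (f x) _))

  sumR-filterᵇ : (Q : X → Bool) (F : X → Carrier) → ∀ xs →
    sumR (map (λ x → if Q x then F x else 0#) xs) ≈ sumR (map F (filterᵇ Q xs))
  sumR-filterᵇ Q F [] = refl
  sumR-filterᵇ Q F (x ∷ xs) with Q x
  ... | true  = +-congˡ (sumR-filterᵇ Q F xs)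
  ... | false = trans (+-identityˡ _) (sumR-filterᵇ Q F xs)

  Σ≤-head : ∀ n (f : ℕ → Carrier) → Σ≤ (suc n) f ≈ f 0 + Σ≤ n (f ∘ suc)
  Σ≤-head n f = reflexive (≡.cong (λ L → f 0 + sumR L)
    (≡.trans (map-applyUpTo suc f (suc n)) (≡.sym (map-applyUpTo (λ k → k) (f ∘ suc) (suc n)))))

  Σ≤-last : ∀ n (f : ℕ → Carrier) → Σ≤ (suc n) f ≈ Σ≤ n f + f (suc n)
  Σ≤-last zero f = solve 2 (λ a b → a :+ (b :+ con 0) := (a :+ con 0) :+ b) refl (f 0) (f 1)
  Σ≤-last (suc n) f = begin
    Σ≤ (suc (suc n)) f                         ≈⟨ Σ≤-head (suc n) f ⟩
    f 0 + Σ≤ (suc n) (f ∘ suc)                 ≈⟨ +-congˡ (Σ≤-last n (f ∘ suc)) ⟩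
    f 0 + (Σ≤ n (f ∘ suc) + f (suc (suc n)))   ≈⟨ +-assoc _ _ _ ⟨
    (f 0 + Σ≤ n (f ∘ suc)) + f (suc (suc n))   ≈⟨ +-congʳ (Σ≤-head n f) ⟨
    Σ≤ (suc n) f + f (suc (suc n))             ∎

  Σ≤-cong : ∀ n {f g : ℕ → Carrier} → (∀ k → k ≤ n → f k ≈ g k) → Σ≤ n f ≈ Σ≤ n g
  Σ≤-cong zero    f≈g = +-congʳ (f≈g 0 z≤n)
  Σ≤-cong (suc n) {f} {g} f≈g = begin
    Σ≤ (suc n) f                ≈⟨ Σ≤-head n f ⟩
    f 0 + Σ≤ n (f ∘ suc)        ≈⟨ +-cong (f≈g 0 z≤n) (Σ≤-cong n (λ k k≤n → f≈g (suc k) (s≤s k≤n))) ⟩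
    g 0 + Σ≤ n (g ∘ suc)        ≈⟨ Σ≤-head n g ⟨
    Σ≤ (suc n) g                ∎

  Σ≤-+ : ∀ n (f g : ℕ → Carrier) → Σ≤ n (λ k → f k + g k) ≈ Σ≤ n f + Σ≤ n g
  Σ≤-+ n f g = sumR-+ f g (upTo (suc n))

  Σ≤-* : ∀ n a (f : ℕ → Carrier) → Σ≤ n (λ k → a * f k) ≈ a * Σ≤ n f
  Σ≤-* n a f = sumR-* a f (upTo (suc n))

  telescope : ∀ n (f g : ℕ → Carrier) → (∀ k → k ≤ n → f k + g k ≈ g (suc k)) →
              Σ≤ n f + g 0 ≈ g (suc n)
  telescope zero f g step = trans (+-congʳ (+-identityʳ (f 0))) (step 0 z≤n)
  telescope (suc n) f g step = begin
    Σ≤ (suc n) f + g 0            ≈⟨ +-congʳ (Σ≤-last n f) ⟩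
    (Σ≤ n f + f (suc n)) + g 0    ≈⟨ solve 3 (λ s a b → (s :+ a) :+ b := a :+ (s :+ b)) refl (Σ≤ n f) (f (suc n)) (g 0) ⟩
    f (suc n) + (Σ≤ n f + g 0)    ≈⟨ +-congˡ (telescope n f g (λ k k≤n → step k (ℕₚ.m≤n⇒m≤1+n k≤n))) ⟩
    f (suc n) + g (suc n)         ≈⟨ step (suc n) ℕₚ.≤-refl ⟩
    g (suc (suc n))               ∎

  summation-by-parts : ∀ n (f g : ℕ → Carrier) → (∀ k → k ≤ n → f k + g k ≈ g (suc k)) →
    Σ≤ n (λ k → nat (k ℕ.+ 1) * f k) + Σ≤ n g ≈ nat (n ℕ.+ 1) * g (suc n)
  summation-by-parts zero f g step = begin
    ((1# + 0#) * f 0 + 0#) + (g 0 + 0#)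
      ≈⟨ solve 2 (λ a b → ((con 1 :+ con 0) :* a :+ con 0) :+ (b :+ con 0) := (con 1 :+ con 0) :* (a :+ b)) refl (f 0) (g 0) ⟩
    (1# + 0#) * (f 0 + g 0)   ≈⟨ *-congˡ (step 0 z≤n) ⟩
    (1# + 0#) * g 1           ∎
  summation-by-parts (suc n) f g step = begin
    Σ≤ (suc n) (λ k → nat (k ℕ.+ 1) * f k) + Σ≤ (suc n) g
      ≈⟨ +-cong (Σ≤-last n (λ k → nat (k ℕ.+ 1) * f k)) (Σ≤-last n g) ⟩
    (S + (1# + w) * a) + (G + b)
      ≈⟨ solve 5 (λ S G w a b → (S :+ (con 1 :+ w) :* a) :+ (G :+ b) := (S :+ G) :+ ((con 1 :+ w) :* a :+ b)) refl S G w a b ⟩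
    (S + G) + ((1# + w) * a + b)
      ≈⟨ +-congʳ (summation-by-parts n f g (λ k k≤n → step k (ℕₚ.m≤n⇒m≤1+n k≤n))) ⟩
    w * b + ((1# + w) * a + b)
      ≈⟨ solve 3 (λ w a b → w :* b :+ ((con 1 :+ w) :* a :+ b) := (con 1 :+ w) :* (a :+ b)) refl w a b ⟩
    (1# + w) * (a + b)        ≈⟨ *-congˡ (step (suc n) ℕₚ.≤-refl) ⟩
    (1# + w) * g (suc (suc n)) ∎
    where
    S = Σ≤ n (λ k → nat (k ℕ.+ 1) * f k)
    G = Σ≤ n g
    w = nat (n ℕ.+ 1)
    a = f (suc n)
    b = g (suc n)

  nat-+ : ∀ x y → nat (x ℕ.+ y) ≈ nat x + nat y
  nat-+ zero    y = sym (+-identityˡ _)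
  nat-+ (suc x) y = trans (+-congˡ (nat-+ x y)) (sym (+-assoc _ _ _))

  -- The weights k + 1 and n − k + 1 add up to the constant n + 2.
  Σ≤-complementary-weights : ∀ n (f : ℕ → Carrier) →
    Σ≤ n (λ k → nat (n ∸ k ℕ.+ 1) * f k) + Σ≤ n (λ k → nat (k ℕ.+ 1) * f k) ≈ nat (n ℕ.+ 2) * Σ≤ n f
  Σ≤-complementary-weights n f = begin
    Σ≤ n (λ k → nat (n ∸ k ℕ.+ 1) * f k) + Σ≤ n (λ k → nat (k ℕ.+ 1) * f k)
      ≈⟨ Σ≤-+ n (λ k → nat (n ∸ k ℕ.+ 1) * f k) (λ k → nat (k ℕ.+ 1) * f k) ⟨
    Σ≤ n (λ k → nat (n ∸ k ℕ.+ 1) * f k + nat (k ℕ.+ 1) * f k)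
      ≈⟨ Σ≤-cong n (λ k k≤n → trans (sym (distribʳ (f k) _ _)) (*-congʳ (weights-sum k k≤n))) ⟩
    Σ≤ n (λ k → nat (n ℕ.+ 2) * f k)   ≈⟨ Σ≤-* n (nat (n ℕ.+ 2)) f ⟩
    nat (n ℕ.+ 2) * Σ≤ n f             ∎
    where
    weights-sum : ∀ k → k ≤ n → nat (n ∸ k ℕ.+ 1) + nat (k ℕ.+ 1) ≈ nat (n ℕ.+ 2)
    weights-sum k k≤n = trans (sym (nat-+ (n ∸ k ℕ.+ 1) (k ℕ.+ 1)))
      (reflexive (≡.cong nat (≡.trans (+1-+1 (n ∸ k) k) (≡.cong (ℕ._+ 2) (ℕₚ.m∸n+n≡m k≤n)))))
      where
      +1-+1 : ∀ d k → (d ℕ.+ 1) ℕ.+ (k ℕ.+ 1) ≡ (d ℕ.+ k) ℕ.+ 2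
      +1-+1 = solve-∀

  divide : ∀ {a u x y} → a * u ≈ 1# → a * x ≈ y → x ≈ y * u
  divide {a} {u} {x} {y} au≈1 ax≈y = begin
    x            ≈⟨ *-identityʳ x ⟨
    x * 1#       ≈⟨ *-congˡ au≈1 ⟨
    x * (a * u)  ≈⟨ solve 3 (λ x a u → x :* (a :* u) := (a :* x) :* u) refl x a u ⟩
    (a * x) * u  ≈⟨ *-congʳ ax≈y ⟩
    y * u        ∎

  unit-square : ∀ {a u} → a * u ≈ 1# → (a * a) * (u * u) ≈ 1#
  unit-square {a} {u} au≈1 = begin
    (a * a) * (u * u)  ≈⟨ solve 2 (λ a u → (a :* a) :* (u :* u) := (a :* u) :* (a :* u)) refl a u ⟩
    (a * u) * (a * u)  ≈⟨ *-cong au≈1 au≈1 ⟩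
    1# * 1#            ≈⟨ *-identityˡ 1# ⟩
    1#                 ∎

  subtract : ∀ {x y z} → x + y ≈ z → x ≈ z - y
  subtract {x} {y} {z} = x≈z//y x y z

  subtract-middle : ∀ {x y z w} → x + y ≈ z + w → x ≈ z - y + w
  subtract-middle {x} {y} {z} {w} eq = trans (subtract eq)
    (solve 3 (λ z w y′ → (z :+ w) :+ y′ := (z :+ y′) :+ w) refl z w (- y))

  module Classification (t : ℕ → Carrier) where

    weight-relabel : ∀ (f : ℕ → ℕ) q → weight t (map (map f) q) ≡ weight t q
    weight-relabel f []      = ≡.refl
    weight-relabel f (b ∷ q) = ≡.cong₂ (λ s w → t s * w) (length-map f b) (weight-relabel f q)

    weight-insertSingleton : ∀ a p → weight t (insertSingleton a p) ≈ t 1 * weight t p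
    weight-insertSingleton a [] = refl
    weight-insertSingleton a (b ∷ p) with liesAbove a b
    ... | true = begin
      t (length (map (shiftAbove a) b)) * weight t (insertSingleton a p)
        ≈⟨ *-cong (reflexive (≡.cong t (length-map (shiftAbove a) b))) (weight-insertSingleton a p) ⟩
      t (length b) * (t 1 * weight t p)
        ≈⟨ solve 3 (λ x y z → x :* (y :* z) := y :* (x :* z)) refl (t (length b)) (t 1) (weight t p) ⟩
      t 1 * weight t (b ∷ p) ∎
    ... | false = *-congˡ (reflexive (weight-relabel (shiftAbove a) (b ∷ p)))

    noSingletonAbove : ℕ → ℕ → Partition → Bool
    noSingletonAbove K j p = not (any (λ i → hasSingletonBlock (suc (j ℕ.+ i)) p) (upTo (K ∸ j)))

    B : ℕ → ℕ → Carrier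
    B K j = sumR (map (λ p → if noSingletonAbove K j p then weight t p else 0#) (partitions K))

    -- Above j = a + 1, singleton blocks are those of p shifted by one.
    noSingletonAbove-insertSingleton : ∀ K a p →
      noSingletonAbove (suc K) (suc a) (insertSingleton a p) ≡ noSingletonAbove K a p
    noSingletonAbove-insertSingleton K a p = ≡.cong (not ∘ or) (map-cong
      (λ j → hasSingleton-insertedAbove a (suc (a ℕ.+ j)) p (≤⇒<ᵇsuc (ℕₚ.m≤m+n a j))) (upTo (K ∸ a)))

    -- A_{K,a} = t₁ · B K a: remove the largest singleton {a + 1} (the bijection singletonFilter).
    A-via-B : ∀ K a → a ≤ K → A t K a ≈ t 1 * B K a
    A-via-B K a a≤K = begin
      A t K a
        ≈⟨ sumR-cong (λ p → reflexive (if-∧ (hasSingletonBlock (suc a) p) (noSingletonAbove (suc K) (suc a) p))) (partitions (suc K)) ⟩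
      sumR (map (λ p → if hasSingletonBlock (suc a) p then F p else 0#) (partitions (suc K)))
        ≈⟨ sumR-filterᵇ (hasSingletonBlock (suc a)) F (partitions (suc K)) ⟩
      sumR (map F (filterᵇ (hasSingletonBlock (suc a)) (partitions (suc K))))
        ≡⟨ ≡.cong (sumR ∘ map F) (singletonFilter a K a≤K) ⟩
      sumR (map F (map (insertSingleton a) (partitions K)))
        ≡⟨ ≡.cong sumR (map-∘ (partitions K)) ⟨
      sumR (map (F ∘ insertSingleton a) (partitions K))
        ≈⟨ sumR-cong removeSingleton (partitions K) ⟩
      sumR (map (λ p → t 1 * (if noSingletonAbove K a p then weight t p else 0#)) (partitions K))
        ≈⟨ sumR-* (t 1) _ (partitions K) ⟩
      t 1 * B K a ∎
      where
      F : Partition → Carrier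
      F p = if noSingletonAbove (suc K) (suc a) p then weight t p else 0#
      if-∧ : ∀ b d {x} → (if b ∧ d then x else 0#) ≡ (if b then (if d then x else 0#) else 0#)
      if-∧ true  d = ≡.refl
      if-∧ false d = ≡.refl
      removeSingleton : ∀ p → F (insertSingleton a p) ≈ t 1 * (if noSingletonAbove K a p then weight t p else 0#)
      removeSingleton p rewrite noSingletonAbove-insertSingleton K a p with noSingletonAbove K a p
      ... | true  = weight-insertSingleton a p
      ... | false = sym (zeroʳ _)

    -- Partitions without singletons above a + 1 either have {a + 1} as their
    -- largest singleton, or have no singleton above a.
    B-step : ∀ N a → a ≤ N → B (suc N) (suc a) ≈ A t N a + B (suc N) a
    B-step N a a≤N = begin
      B (suc N) (suc a)
        ≈⟨ sumR-cong (λ p → trans (indicator-split (hasSingletonBlock (suc a) p) (above p) (weight t p))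
                                  (+-congˡ (reflexive (≡.cong (λ z → if not z then weight t p else 0#) (≡.sym (singletonsAbove-split N a p a≤N))))))
                     (partitions (suc N)) ⟩
      sumR (map (λ p → (if hasSingletonBlock (suc a) p ∧ not (above p) then weight t p else 0#)
                     + (if noSingletonAbove (suc N) a p then weight t p else 0#)) (partitions (suc N)))
        ≈⟨ sumR-+ _ _ (partitions (suc N)) ⟩
      A t N a + B (suc N) a ∎
      where
      above : Partition → Bool
      above p = any (λ i → hasSingletonBlock (suc (suc a ℕ.+ i)) p) (upTo (N ∸ a))
      indicator-split : ∀ h r x → (if not r then x else 0#) ≈ (if h ∧ not r then x else 0#) + (if not (h ∨ r) then x else 0#)
      indicator-split true  r x = sym (+-identityʳ _)
      indicator-split false r x = sym (+-identityˡ _)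

    -- Above K there is nothing to exclude.
    B-saturated : ∀ K j → K ≤ j → B K j ≈ 𝒴 t K
    B-saturated K j K≤j = sumR-cong (λ p → reflexive (≡.cong (λ z → if not (any (λ i → hasSingletonBlock (suc (j ℕ.+ i)) p) (upTo z)) then weight t p else 0#)
                                                                (ℕₚ.m≤n⇒m∸n≡0 K≤j)))
                                    (partitions K)

    B-step-from : ∀ N a n → a ℕ.+ n ≡ N → ∀ k → k ≤ n →
      A t N (a ℕ.+ k) + B (suc N) (a ℕ.+ k) ≈ B (suc N) (a ℕ.+ suc k)
    B-step-from N a n a+n≡N k k≤n =
      trans (sym (B-step N (a ℕ.+ k) (ℕₚ.≤-trans (ℕₚ.+-monoʳ-≤ a k≤n) (ℕₚ.≤-reflexive a+n≡N))))
            (reflexive (≡.cong (B (suc N)) (≡.sym (ℕₚ.+-suc a k))))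

    B-saturated-from : ∀ N a n → a ℕ.+ n ≡ N → B (suc N) (a ℕ.+ suc n) ≈ 𝒴 t (suc N)
    B-saturated-from N a n a+n≡N = B-saturated (suc N) (a ℕ.+ suc n)
      (ℕₚ.≤-reflexive (≡.trans (≡.cong suc (≡.sym a+n≡N)) (≡.sym (ℕₚ.+-suc a n))))

    largest-singleton-classification : ∀ N a n → a ℕ.+ n ≡ N →
      Σ≤ n (λ k → A t N (a ℕ.+ k)) + B (suc N) a ≈ 𝒴 t (suc N)
    largest-singleton-classification N a n a+n≡N = begin
      Σ≤ n (λ k → A t N (a ℕ.+ k)) + B (suc N) a
        ≈⟨ +-congˡ (reflexive (≡.cong (B (suc N)) (ℕₚ.+-identityʳ a))) ⟨
      Σ≤ n (λ k → A t N (a ℕ.+ k)) + B (suc N) (a ℕ.+ 0)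
        ≈⟨ telescope n (λ k → A t N (a ℕ.+ k)) (λ k → B (suc N) (a ℕ.+ k)) (B-step-from N a n a+n≡N) ⟩
      B (suc N) (a ℕ.+ suc n)
        ≈⟨ B-saturated-from N a n a+n≡N ⟩
      𝒴 t (suc N) ∎

  module Cleared (t : ℕ → Carrier) (n m : ℕ) where
    open Classification t

    N : ℕ
    N = n ℕ.+ m

    t₁ : Carrier
    t₁ = t 1

    -- α k = A_{N,m+k} is summed; β k = B (N + 1) (m + k) telescopes it.
    α β : ℕ → Carrier
    α k = A t N (m ℕ.+ k)
    β k = B (suc N) (m ℕ.+ k)

    m+n≡N : m ℕ.+ n ≡ N
    m+n≡N = ℕₚ.+-comm m n

    m+1+n≡1+N : m ℕ.+ suc n ≡ suc N
    m+1+n≡1+N = ≡.trans (ℕₚ.+-suc m n) (≡.cong suc m+n≡N)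

    first-cleared : t₁ * Σ≤ n α + A t (suc N) m ≈ t₁ * 𝒴 t (suc N)
    first-cleared = begin
      t₁ * Σ≤ n α + A t (suc N) m      ≈⟨ +-congˡ (A-via-B (suc N) m (ℕₚ.m≤n⇒m≤1+n (ℕₚ.m≤n+m m n))) ⟩
      t₁ * Σ≤ n α + t₁ * B (suc N) m   ≈⟨ distribˡ t₁ _ _ ⟨
      t₁ * (Σ≤ n α + B (suc N) m)      ≈⟨ *-congˡ (largest-singleton-classification N m n m+n≡N) ⟩
      t₁ * 𝒴 t (suc N)                 ∎

    -- One level up, the values t₁ β k are the A_{N+1,m+k}, which classify [N + 2].
    level-up : t₁ * (Σ≤ n β + 𝒴 t (suc N)) + B (suc (suc N)) m ≈ 𝒴 t (suc (suc N))
    level-up = begin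
      t₁ * (Σ≤ n β + 𝒴 t (suc N)) + B (suc (suc N)) m
        ≈⟨ +-congʳ (*-congˡ (+-congˡ (B-saturated-from N m n m+n≡N))) ⟨
      t₁ * (Σ≤ n β + β (suc n)) + B (suc (suc N)) m
        ≈⟨ +-congʳ (*-congˡ (Σ≤-last n β)) ⟨
      t₁ * Σ≤ (suc n) β + B (suc (suc N)) m
        ≈⟨ +-congʳ (Σ≤-* (suc n) t₁ β) ⟨
      Σ≤ (suc n) (λ k → t₁ * β k) + B (suc (suc N)) m
        ≈⟨ +-congʳ (Σ≤-cong (suc n) (λ k k≤1+n → sym (A-via-B (suc N) (m ℕ.+ k)
             (ℕₚ.≤-trans (ℕₚ.+-monoʳ-≤ m k≤1+n) (ℕₚ.≤-reflexive m+1+n≡1+N))))) ⟩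
      Σ≤ (suc n) (λ k → A t (suc N) (m ℕ.+ k)) + B (suc (suc N)) m
        ≈⟨ largest-singleton-classification (suc N) m (suc n) m+1+n≡1+N ⟩
      𝒴 t (suc (suc N)) ∎

    second-cleared : (t₁ * t₁) * Σ≤ n (λ k → nat (k ℕ.+ 1) * α k) + t₁ * 𝒴 t (suc (suc N))
                   ≈ A t (suc (suc N)) m + nat (n ℕ.+ 2) * (t₁ * t₁) * 𝒴 t (suc N)
    second-cleared = begin
      (t₁ * t₁) * S + t₁ * Y₂                           ≈⟨ +-congˡ (*-congˡ level-up) ⟨
      (t₁ * t₁) * S + t₁ * (t₁ * (Σ≤ n β + Y₁) + B₂)
        ≈⟨ solve 5 (λ a s b y z → (a :* a) :* s :+ a :* (a :* (b :+ y) :+ z) := (a :* a) :* (s :+ b) :+ (a :* a) :* y :+ a :* z)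
                   refl t₁ S (Σ≤ n β) Y₁ B₂ ⟩
      (t₁ * t₁) * (S + Σ≤ n β) + (t₁ * t₁) * Y₁ + t₁ * B₂
        ≈⟨ +-congʳ (+-congʳ (*-congˡ by-parts)) ⟩
      (t₁ * t₁) * (nat (n ℕ.+ 1) * Y₁) + (t₁ * t₁) * Y₁ + t₁ * B₂
        ≈⟨ solve 4 (λ a w y z → (a :* a) :* (w :* y) :+ (a :* a) :* y :+ a :* z := a :* z :+ (con 1 :+ w) :* (a :* a) :* y)
                   refl t₁ (nat (n ℕ.+ 1)) Y₁ B₂ ⟩
      t₁ * B₂ + nat (suc (n ℕ.+ 1)) * (t₁ * t₁) * Y₁
        ≈⟨ +-congˡ (*-congʳ (*-congʳ (reflexive (≡.cong nat (ℕₚ.+-suc n 1))))) ⟨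
      t₁ * B₂ + nat (n ℕ.+ 2) * (t₁ * t₁) * Y₁
        ≈⟨ +-congʳ (A-via-B (suc (suc N)) m (ℕₚ.m≤n⇒m≤1+n (ℕₚ.m≤n⇒m≤1+n (ℕₚ.m≤n+m m n)))) ⟨
      A t (suc (suc N)) m + nat (n ℕ.+ 2) * (t₁ * t₁) * Y₁ ∎
      where
      S  = Σ≤ n (λ k → nat (k ℕ.+ 1) * α k)
      Y₁ = 𝒴 t (suc N)
      Y₂ = 𝒴 t (suc (suc N))
      B₂ = B (suc (suc N)) m
      by-parts : S + Σ≤ n β ≈ nat (n ℕ.+ 1) * Y₁
      by-parts = trans (summation-by-parts n α β (B-step-from N m n m+n≡N))
                       (*-congˡ (B-saturated-from N m n m+n≡N))

    -- Since (n − k + 1) + (k + 1) = n + 2, the third sum is (n + 2) times the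
    -- first minus the second.
    third-cleared : (t₁ * t₁) * Σ≤ n (λ k → nat (n ∸ k ℕ.+ 1) * α k) + nat (n ℕ.+ 2) * t₁ * A t (suc N) m
                      + A t (suc (suc N)) m
                  ≈ t₁ * 𝒴 t (suc (suc N))
    third-cleared = +-cancelʳ (t₂ * S₂) _ _ (begin
      (t₂ * S₃ + w * t₁ * A₁ + A₂) + t₂ * S₂
        ≈⟨ solve 6 (λ a s₃ w a₁ a₂ s₂ → ((a :* a) :* s₃ :+ w :* a :* a₁ :+ a₂) :+ (a :* a) :* s₂
                                        := (a :* a) :* (s₃ :+ s₂) :+ w :* a :* a₁ :+ a₂)
                   refl t₁ S₃ w A₁ A₂ S₂ ⟩
      t₂ * (S₃ + S₂) + w * t₁ * A₁ + A₂
        ≈⟨ +-congʳ (+-congʳ (*-congˡ (Σ≤-complementary-weights n α))) ⟩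
      t₂ * (w * Σ≤ n α) + w * t₁ * A₁ + A₂
        ≈⟨ solve 5 (λ a w s a₁ a₂ → (a :* a) :* (w :* s) :+ w :* a :* a₁ :+ a₂ := w :* a :* (a :* s :+ a₁) :+ a₂)
                   refl t₁ w (Σ≤ n α) A₁ A₂ ⟩
      w * t₁ * (t₁ * Σ≤ n α + A₁) + A₂
        ≈⟨ +-congʳ (*-congˡ first-cleared) ⟩
      w * t₁ * (t₁ * Y₁) + A₂
        ≈⟨ solve 4 (λ w a y a₂ → w :* a :* (a :* y) :+ a₂ := a₂ :+ w :* (a :* a) :* y) refl w t₁ Y₁ A₂ ⟩
      A₂ + w * t₂ * Y₁
        ≈⟨ second-cleared ⟨
      t₂ * S₂ + t₁ * Y₂
        ≈⟨ +-comm _ _ ⟩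
      t₁ * Y₂ + t₂ * S₂ ∎)
      where
      t₂ = t₁ * t₁
      w  = nat (n ℕ.+ 2)
      S₂ = Σ≤ n (λ k → nat (k ℕ.+ 1) * α k)
      S₃ = Σ≤ n (λ k → nat (n ∸ k ℕ.+ 1) * α k)
      A₁ = A t (suc N) m
      A₂ = A t (suc (suc N)) m
      Y₁ = 𝒴 t (suc N)
      Y₂ = 𝒴 t (suc (suc N))

corollary2p4 : ∀ {c ℓ} (R : CommutativeRing c ℓ) →
    let open CommutativeRing R
        open Weighted R
    in (t : ℕ → Carrier) (u : Carrier) → t 1 * u ≈ 1# → (n m : ℕ) →
       (Σ≤ n (λ k → A t (n ℕ.+ m) (m ℕ.+ k))
          ≈ (t 1 * 𝒴 t (n ℕ.+ m ℕ.+ 1) - A t (n ℕ.+ m ℕ.+ 1) m) * u)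
       × (Σ≤ n (λ k → nat (k ℕ.+ 1) * A t (n ℕ.+ m) (m ℕ.+ k))
          ≈ (A t (n ℕ.+ m ℕ.+ 2) m - t 1 * 𝒴 t (n ℕ.+ m ℕ.+ 2)
              + nat (n ℕ.+ 2) * (t 1 * t 1) * 𝒴 t (n ℕ.+ m ℕ.+ 1)) * (u * u))
       × (Σ≤ n (λ k → nat (n ℕ.∸ k ℕ.+ 1) * A t (n ℕ.+ m) (m ℕ.+ k))
          ≈ (t 1 * 𝒴 t (n ℕ.+ m ℕ.+ 2) - A t (n ℕ.+ m ℕ.+ 2) m
              - nat (n ℕ.+ 2) * t 1 * A t (n ℕ.+ m ℕ.+ 1) m) * (u * u))
corollary2p4 R t u t₁u≈1 n m
  rewrite ℕₚ.+-comm (n ℕ.+ m) 1 | ℕₚ.+-comm (n ℕ.+ m) 2 =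
    divide t₁u≈1 (subtract first-cleared) ,
    divide (unit-square t₁u≈1) (subtract-middle second-cleared) ,
    divide (unit-square t₁u≈1) (subtract (subtract third-cleared))
  where
  open WeightedIdentities R
  open Cleared t n m
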